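{- For conjunctive systems, for every $n\ge1$: if $(A,B)^{(1,n)}$ has a deadlock, then $(A,B)^{(1,n+1)}$ has a deadlock.
   Context: Guarded systems. Fix disjoint finite sets $Q_A,Q_B$. A process template is $U=(Q_U,\mathit{init}_U,\Sigma_U,\delta_U)$ for $U\in\{A,B\}$: finite states, initial state, finite input alphabet, guarded transitions $\delta_U\subseteq Q_U\times\Sigma_U\times2^{Q_A\cup Q_B}\times Q_U$. In conjunctive systems $\mathit{init}_A$ and $\mathit{init}_B$ belong to every guard. The system $(A,B)^{(1,n)}$ has processes $A,B_1,\dots,B_n$ ($B_i$ copies of $B$); a global state $s$ gives each process $p$ a local state $s(p)$, a global input $e$ gives each $p$ an input $e(p)$; initially all processes are in their initial states. A local transition $(q,\sigma,g,q')$ of $p$ is enabled in $(s,e)$ if $s(p)=q$, $e(p)=\sigma$ and (conjunctive) every process $p'\neq p$ has $s(p')\in g$; $p$ is enabled if some transition of $p$ is. Exactly one process moves per global step. A path is a sequence $(s_1,e_1,p_1)(s_2,e_2,p_2)\dots$ where $s_{j+1}$ results from $s_j$ by an enabled transition of $p_j$ under $e_j$, $e_{j+1}(p)=e_j(p)$ for $p\ne p_j$, and a configuration $(s,e,\bot)$ occurs (as last) exactly when all processes are disabled. A run is a maximal path from the initial state. A run is globally deadlocked if finite; an infinite run is locally deadlocked if some process is disabled at all moments from some point on. A system has a deadlock if it has a globally or locally deadlocked run. -}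

module Defs where

open import Data.Nat using (ℕ; zero; suc; _<_; _≤_)
open import Data.Fin using (Fin)
open import Data.Bool using (Bool; true)
open import Data.Sum using (_⊎_; inj₁; inj₂)
open import Data.Product using (Σ; _×_; _,_; ∃; ∃-syntax)
open import Data.List using (List)
open import Data.List.Membership.Propositional using (_∈_)
open import Relation.Binary.PropositionalEquality using (_≡_; _≢_)
open import Relation.Nullary using (¬_)

-- Q_A = Fin a, Q_B = Fin b; disjointness is built in via the sum Q_A ⊎ Q_B.
-- A guard is a subset of Q_A ∪ Q_B, given by its characteristic function.
Guard : ℕ → ℕ → Set
Guard a b = Fin a ⊎ Fin b → Bool

record Trans (a b : ℕ) (Q Sig : Set) : Set where
  constructor trans
  field
    src : Q
    lab : Sig
    grd : Guard a b
    tgt : Q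
open Trans public

record Template (a b : ℕ) (Q : Set) : Set where
  field
    alph : ℕ
    init : Q
    δ    : List (Trans a b Q (Fin alph))
open Template public

TemplateA : ℕ → ℕ → Set
TemplateA a b = Template a b (Fin a)

TemplateB : ℕ → ℕ → Set
TemplateB a b = Template a b (Fin b)

Conjunctive : ∀ {a b} → TemplateA a b → TemplateB a b → Set
Conjunctive {a} {b} A B =
  (∀ t → t ∈ δ A → grd t (inj₁ (init A)) ≡ true × grd t (inj₂ (init B)) ≡ true) ×
  (∀ t → t ∈ δ B → grd t (inj₁ (init A)) ≡ true × grd t (inj₂ (init B)) ≡ true)

-- Processes of (A,B)^(1,n): A and B_1 … B_n (indexed by Fin n).
data Proc (n : ℕ) : Set where
  pA : Proc n
  pB : Fin n → Proc n

module System {a b : ℕ} (A : TemplateA a b) (B : TemplateB a b) (n : ℕ) where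

  record GState : Set where
    constructor gstate
    field
      sA : Fin a
      sB : Fin n → Fin b
  open GState public

  record Input : Set where
    constructor input
    field
      eA : Fin (alph A)
      eB : Fin n → Fin (alph B)
  open Input public

  Config : Set
  Config = GState × Input

  loc : GState → Proc n → Fin a ⊎ Fin b
  loc s pA     = inj₁ (sA s)
  loc s (pB i) = inj₂ (sB s i)

  GuardHolds : Guard a b → GState → Proc n → Set
  GuardHolds g s p = ∀ p' → p' ≢ p → g (loc s p') ≡ true

  EnabledTransA : GState → Input → Trans a b (Fin a) (Fin (alph A)) → Set
  EnabledTransA s e t =
    t ∈ δ A × src t ≡ sA s × lab t ≡ eA e × GuardHolds (grd t) s pA

  EnabledTransB : GState → Input → Fin n → Trans a b (Fin b) (Fin (alph B)) → Set
  EnabledTransB s e i t =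
    t ∈ δ B × src t ≡ sB s i × lab t ≡ eB e i × GuardHolds (grd t) s (pB i)

  Enabled : Config → Proc n → Set
  Enabled (s , e) pA     = ∃[ t ] EnabledTransA s e t
  Enabled (s , e) (pB i) = ∃[ t ] EnabledTransB s e i t

  Step : Config → Proc n → Config → Set
  Step (s , e) pA (s' , e') =
    ∃[ t ] (EnabledTransA s e t × sA s' ≡ tgt t ×
            (∀ j → sB s' j ≡ sB s j) × (∀ j → eB e' j ≡ eB e j))
  Step (s , e) (pB i) (s' , e') =
    ∃[ t ] (EnabledTransB s e i t × sB s' i ≡ tgt t ×
            (∀ j → j ≢ i → sB s' j ≡ sB s j) × sA s' ≡ sA s ×
            eA e' ≡ eA e × (∀ j → j ≢ i → eB e' j ≡ eB e j))

  Initial : Config → Set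
  Initial (s , e) = sA s ≡ init A × (∀ i → sB s i ≡ init B)

  GloballyDeadlocked : Set
  GloballyDeadlocked =
    Σ ℕ λ m → Σ (ℕ → Config) λ c → Σ (ℕ → Proc n) λ π →
      Initial (c 0) ×
      (∀ j → j < m → Step (c j) (π j) (c (suc j))) ×
      (∀ p → ¬ Enabled (c m) p)

  LocallyDeadlocked : Set
  LocallyDeadlocked =
    Σ (ℕ → Config) λ c → Σ (ℕ → Proc n) λ π →
      Initial (c 0) ×
      (∀ j → Step (c j) (π j) (c (suc j))) ×
      (∃[ p ] ∃[ k ] (∀ j → k ≤ j → ¬ Enabled (c j) p))

  HasDeadlock : Set
  HasDeadlock = GloballyDeadlocked ⊎ LocallyDeadlocked

HasDeadlock : ∀ {a b} → TemplateA a b → TemplateB a b → ℕ → Set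
HasDeadlock A B n = System.HasDeadlock A B n

module Submission where

-- Add a newcomer B₀ to the deadlocked system, starting in init_B.
-- Since init_B satisfies every guard, the old run lifts step by step to the
-- bigger system with B₀ idle, and an old process that is disabled stays
-- disabled (the newcomer only adds a conjunct to its guards).
--   * A local deadlock lifts verbatim: B₀ simply never moves.
--   * After a global deadlock every old process is disabled forever; let B₀
--     move alone, always taking the first enabled transition.  Its states
--     form the orbit of a map on the finite set Q_B, which is eventually
--     periodic; hence B₀ is either disabled at some first moment (a global
--     deadlock) or enabled forever (an infinite run in which A is disabled
--     from then on: a local deadlock).

open import Defs
open import Data.Nat using (ℕ; zero; suc; _+_; _∸_; _≤_; _<_; z≤n; s≤s)
import Data.Nat.Properties as ℕₚ
open import Data.Nat.GeneralisedArithmetic using (fold; fold-+)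
open import Data.Fin using (Fin; toℕ)
import Data.Fin as Fin
import Data.Fin.Properties as Finₚ
import Data.Bool as Bool
open import Data.Bool using (true)
open import Data.Empty using (⊥-elim)
open import Data.Sum using (_⊎_; inj₁; inj₂)
open import Data.Product using (_×_; _,_; ∃; proj₁; proj₂)
open import Data.List.Relation.Unary.Any using (any?)
open import Data.List.Membership.Propositional using (_∈_; find; lose)
open import Data.Vec.Functional using (_∷_)
open import Function using (_∘_; const)
open import Relation.Binary.Definitions using (DecidableEquality)
open import Relation.Binary.PropositionalEquality
  using (_≡_; _≢_; refl; sym; cong; subst; module ≡-Reasoning)
  renaming (trans to ≡-trans)
open import Relation.Nullary using (¬_; Dec; yes; no)
open import Relation.Nullary.Decidable using (map′; ¬?; _×-dec_; _→-dec_)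
open import Relation.Unary using (Decidable)

PathUpTo : {C P : Set} → (C → P → C → Set) → (ℕ → C) → (ℕ → P) → ℕ → Set
PathUpTo R c π k = ∀ j → j < k → R (c j) (π j) (c (suc j))

InfinitePath : {C P : Set} → (C → P → C → Set) → (ℕ → C) → (ℕ → P) → Set
InfinitePath R c π = ∀ j → R (c j) (π j) (c (suc j))

splice : {X : Set} → ℕ → (ℕ → X) → (ℕ → X) → ℕ → X
splice zero    x y j       = y j
splice (suc m) x y zero    = x zero
splice (suc m) x y (suc j) = splice m (x ∘ suc) y j

splice-head : {X : Set} (m : ℕ) {x y : ℕ → X} → x m ≡ y 0 → splice m x y 0 ≡ x 0
splice-head zero    x₀≡y₀ = sym x₀≡y₀
splice-head (suc m) _     = refl

splice-+ : {X : Set} (m d : ℕ) {x y : ℕ → X} → splice m x y (m + d) ≡ y d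
splice-+ zero    d = refl
splice-+ (suc m) d = splice-+ m d

splice-path : {C P : Set} (R : C → P → C → Set) (m k : ℕ)
  {x y : ℕ → C} {π ρ : ℕ → P} → x m ≡ y 0 →
  PathUpTo R x π m → PathUpTo R y ρ k →
  PathUpTo R (splice m x y) (splice m π ρ) (m + k)
splice-path R zero    k _     _  py = py
splice-path R (suc m) k {x} {π = π} xₘ≡y₀ px py zero _ =
  subst (R (x 0) (π 0)) (sym (splice-head m xₘ≡y₀)) (px 0 (s≤s z≤n))
splice-path R (suc m) k xₘ≡y₀ px py (suc j) (s≤s j<m+k) =
  splice-path R m k xₘ≡y₀ (λ i i<m → px (suc i) (s≤s i<m)) py j j<m+k

splice-path-∞ : {C P : Set} (R : C → P → C → Set) (m : ℕ)
  {x y : ℕ → C} {π ρ : ℕ → P} → x m ≡ y 0 →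
  PathUpTo R x π m → InfinitePath R y ρ →
  InfinitePath R (splice m x y) (splice m π ρ)
splice-path-∞ R m xₘ≡y₀ px py j =
  splice-path R m (suc j) xₘ≡y₀ px (λ i _ → py i) j (ℕₚ.m≤n+m (suc j) m)

orbit : ∀ {b} → (Fin b → Fin b) → Fin b → ℕ → Fin b
orbit g q = fold q g

orbit-shift : ∀ {b} (g : Fin b → Fin b) q {i j} →
  orbit g q i ≡ orbit g q j → ∀ d → orbit g q (d + i) ≡ orbit g q (d + j)
orbit-shift g q {i} {j} eq d = begin
  orbit g q (d + i)          ≡⟨ fold-+ q g d ⟩
  fold (orbit g q i) g d     ≡⟨ cong (λ r → fold r g d) eq ⟩
  fold (orbit g q j) g d     ≡⟨ fold-+ q g d ⟨
  orbit g q (d + j)          ∎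
  where open ≡-Reasoning

-- By pigeonhole among the first b+1 points, the (b+1)-st point repeats one of them.
orbit-wraps : ∀ {b} (g : Fin b → Fin b) q → ∃ λ y → y ≤ b × orbit g q (suc b) ≡ orbit g q y
orbit-wraps {b} g q
  with I , J , I<J , eq ← Finₚ.pigeonhole (ℕₚ.n<1+n b) (orbit g q ∘ toℕ) =
  d + i , ℕₚ.≤-pred d+i<1+b , wrap
  where
  i j d : ℕ
  i = toℕ I
  j = toℕ J
  d = suc b ∸ j
  d+j≡1+b : d + j ≡ suc b
  d+j≡1+b = ℕₚ.m∸n+n≡m (ℕₚ.<⇒≤ (Finₚ.toℕ<n J))
  d+i<1+b : d + i < suc b
  d+i<1+b = subst (d + i <_) d+j≡1+b (ℕₚ.+-monoʳ-< d I<J)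
  wrap : orbit g q (suc b) ≡ orbit g q (d + i)
  wrap = subst (λ k → orbit g q k ≡ orbit g q (d + i)) d+j≡1+b
               (sym (orbit-shift g q eq d))

orbit-recurrent : ∀ {b} (g : Fin b → Fin b) q x → ∃ λ y → y ≤ b × orbit g q x ≡ orbit g q y
orbit-recurrent g q zero = 0 , z≤n , refl
orbit-recurrent g q (suc x) with orbit-recurrent g q x
... | y , y≤b , eq with ℕₚ.m≤n⇒m<n∨m≡n y≤b
...   | inj₁ y<b  = suc y , y<b , cong g eq
...   | inj₂ refl with orbit-wraps g q
...     | y′ , y′≤b , wrap = y′ , y′≤b , ≡-trans (cong g eq) wrap

first-failure : {P : ℕ → Set} → Decidable P → ∀ N →
  (∀ j → j < N → P j) ⊎ ∃ λ k → (∀ j → j < k → P j) × ¬ P k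
first-failure P? zero = inj₁ λ _ ()
first-failure {P} P? (suc N) with first-failure P? N | P? N
... | inj₂ failure | _      = inj₂ failure
... | inj₁ below   | no ¬pN = inj₂ (N , below , ¬pN)
... | inj₁ below   | yes pN = inj₁ below-suc
  where
  below-suc : ∀ j → j < suc N → P j
  below-suc j j<1+N with ℕₚ.m<1+n⇒m<n∨m≡n j<1+N
  ... | inj₁ j<N  = below j j<N
  ... | inj₂ refl = pN

-- An orbit in a finite set stays in a decidable set P forever, or leaves it
-- at a first moment.  Only the first b+1 points need to be inspected.
orbit-dichotomy : ∀ {b} {P : Fin b → Set} → Decidable P → ∀ (g : Fin b → Fin b) q →
  (∀ k → P (orbit g q k)) ⊎
  ∃ λ k → (∀ j → j < k → P (orbit g q j)) × ¬ P (orbit g q k)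
orbit-dichotomy {b} {P} P? g q with first-failure (P? ∘ orbit g q) (suc b)
... | inj₂ failure = inj₂ failure
... | inj₁ below   = inj₁ always
  where
  always : ∀ k → P (orbit g q k)
  always k with y , y≤b , eq ← orbit-recurrent g q k = subst P (sym eq) (below y (s≤s y≤b))

∃∈? : {X : Set} {P : X → Set} → Decidable P → ∀ xs → Dec (∃ λ x → x ∈ xs × P x)
∃∈? P? xs = map′ find (λ (_ , x∈xs , px) → lose x∈xs px) (any? P? xs)

_≟ₚ_ : ∀ {n} → DecidableEquality (Proc n)
pA   ≟ₚ pA   = yes refl
pA   ≟ₚ pB _ = no λ ()
pB _ ≟ₚ pA   = no λ ()
pB i ≟ₚ pB j = map′ (cong pB) (λ { refl → refl }) (i Fin.≟ j)

∀-proc? : ∀ {n} {P : Proc n → Set} → Decidable P → Dec (∀ p → P p)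
∀-proc? {P = P} P? = map′ to (λ all → all pA , all ∘ pB) (P? pA ×-dec Finₚ.all? (P? ∘ pB))
  where
  to : P pA × (∀ i → P (pB i)) → ∀ p → P p
  to (onA , _)  pA     = onA
  to (_ , onB) (pB i) = onB i

module Decide {a b : ℕ} (A : TemplateA a b) (B : TemplateB a b) (n : ℕ) where
  open System A B n

  guardHolds? : ∀ g s p → Dec (GuardHolds g s p)
  guardHolds? g s p = ∀-proc? λ p′ → ¬? (p′ ≟ₚ p) →-dec (g (loc s p′) Bool.≟ true)

  enabled? : ∀ c p → Dec (Enabled c p)
  enabled? (s , e) pA = ∃∈? (λ t →
    (src t Fin.≟ sA s) ×-dec (lab t Fin.≟ eA e) ×-dec guardHolds? (grd t) s pA) (δ A)
  enabled? (s , e) (pB i) = ∃∈? (λ t →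
    (src t Fin.≟ sB s i) ×-dec (lab t Fin.≟ eB e i) ×-dec guardHolds? (grd t) s (pB i)) (δ B)

-- Embedding (A,B)^(1,n) into (A,B)^(1,n+1): the old processes keep their
-- names (B_i becomes B_{i+1}) and a newcomer B₀ is added.
module Extension {a b : ℕ} (A : TemplateA a b) (B : TemplateB a b) (n : ℕ) where
  module S = System A B n
  module T = System A B (suc n)
  open Decide A B (suc n) using (enabled?)

  Admitted : Fin b → Set
  Admitted q = (∀ t → t ∈ δ A → grd t (inj₂ q) ≡ true) ×
               (∀ t → t ∈ δ B → grd t (inj₂ q) ≡ true)

  old : Proc n → Proc (suc n)
  old pA     = pA
  old (pB i) = pB (Fin.suc i)

  newcomer : Proc (suc n)
  newcomer = pB Fin.zero

  -- Needed to transport the condition p′ ≢ p of a guard between the systems.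
  old-injective : ∀ {p p′} → old p ≡ old p′ → p ≡ p′
  old-injective {pA}   {pA}    _    = refl
  old-injective {pB i} {pB .i} refl = refl

  extendState : Fin b → S.GState → T.GState
  extendState q s = T.gstate (S.sA s) (q ∷ S.sB s)

  extend : Fin b → Fin (alph B) → S.Config → T.Config
  extend q σ c = extendState q (proj₁ c) , T.input (S.eA (proj₂ c)) (σ ∷ S.eB (proj₂ c))

  -- The newcomer only adds a conjunct to the guard of an old process ...
  guard-restrict : ∀ g {q s p} → T.GuardHolds g (extendState q s) (old p) → S.GuardHolds g s p
  guard-restrict g holds pA     p≢ = holds pA (p≢ ∘ old-injective)
  guard-restrict g holds (pB i) p≢ = holds (pB (Fin.suc i)) (p≢ ∘ old-injective)

  guard-extend : ∀ g {q s p} → g (inj₂ q) ≡ true → S.GuardHolds g s p →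
    T.GuardHolds g (extendState q s) (old p)
  guard-extend g gq holds pA               p≢ = holds pA (p≢ ∘ cong old)
  guard-extend g gq holds (pB Fin.zero)    p≢ = gq
  guard-extend g gq holds (pB (Fin.suc i)) p≢ = holds (pB i) (p≢ ∘ cong old)

  enabled-restrict : ∀ {q σ c} p → T.Enabled (extend q σ c) (old p) → S.Enabled c p
  enabled-restrict pA     (t , t∈ , src≡ , lab≡ , holds) =
    t , t∈ , src≡ , lab≡ , guard-restrict (grd t) holds
  enabled-restrict (pB i) (t , t∈ , src≡ , lab≡ , holds) =
    t , t∈ , src≡ , lab≡ , guard-restrict (grd t) holds

  ∷-frame : ∀ {X : Set} (x : X) {f f′ : Fin n → X} →
    (∀ j → f′ j ≡ f j) → ∀ j → (x ∷ f′) j ≡ (x ∷ f) j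
  ∷-frame x frame Fin.zero    = refl
  ∷-frame x frame (Fin.suc j) = frame j

  ∷-frame-except : ∀ {X : Set} (x : X) {f f′ : Fin n → X} i →
    (∀ j → j ≢ i → f′ j ≡ f j) → ∀ j → j ≢ Fin.suc i → (x ∷ f′) j ≡ (x ∷ f) j
  ∷-frame-except x i frame Fin.zero    _  = refl
  ∷-frame-except x i frame (Fin.suc j) j≢ = frame j (j≢ ∘ cong Fin.suc)

  step-lift : ∀ {q σ c c′} p → Admitted q → S.Step c p c′ →
    T.Step (extend q σ c) (old p) (extend q σ c′)
  step-lift pA (admA , _) (t , (t∈ , src≡ , lab≡ , holds) , tgt≡ , frame , frameᵉ) =
    t , (t∈ , src≡ , lab≡ , guard-extend (grd t) (admA t t∈) holds) , tgt≡ ,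
    ∷-frame _ frame , ∷-frame _ frameᵉ
  step-lift (pB i) (_ , admB) (t , (t∈ , src≡ , lab≡ , holds) , tgt≡ , frame , sA≡ , eA≡ , frameᵉ) =
    t , (t∈ , src≡ , lab≡ , guard-extend (grd t) (admB t t∈) holds) , tgt≡ ,
    ∷-frame-except _ i frame , sA≡ , eA≡ , ∷-frame-except _ i frameᵉ

  newcomer-step : ∀ {q σ c} t →
    T.EnabledTransB (extendState q (proj₁ c)) (proj₂ (extend q σ c)) Fin.zero t →
    T.Step (extend q σ c) newcomer (extend (tgt t) σ c)
  newcomer-step t enabled = t , enabled , refl , unchanged , refl , refl , (λ _ _ → refl)
    where
    unchanged : ∀ {X : Set} {q q′ : X} {f} j → j ≢ Fin.zero → (q′ ∷ f) j ≡ (q ∷ f) j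
    unchanged Fin.zero    j≢ = ⊥-elim (j≢ refl)
    unchanged (Fin.suc j) _  = refl

  initial-lift : ∀ σ c → S.Initial c → T.Initial (extend (init B) σ c)
  initial-lift σ c (sA≡ , sB≡) = sA≡ , λ { Fin.zero → refl ; (Fin.suc i) → sB≡ i }

  -- Runs are lifted with the newcomer idle in init_B, which every guard admits.
  module Lift (admitted : Admitted (init B)) (σ : Fin (alph B)) where

    lift : S.Config → T.Config
    lift = extend (init B) σ

    path-lift : ∀ {c π k} → PathUpTo S.Step c π k → PathUpTo T.Step (lift ∘ c) (old ∘ π) k
    path-lift path j j<k = step-lift _ admitted (path j j<k)

    local-deadlock-lifts : S.LocallyDeadlocked → T.LocallyDeadlocked
    local-deadlock-lifts (c , π , initial , path , p , k , dead) =
      lift ∘ c , old ∘ π , initial-lift σ (c 0) initial ,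
      (λ j → step-lift (π j) admitted (path j)) ,
      old p , k , λ j k≤j → dead j k≤j ∘ enabled-restrict p

    module AfterGlobalDeadlock (m : ℕ) (c : ℕ → S.Config) (π : ℕ → Proc n)
        (initial : S.Initial (c 0)) (path : PathUpTo S.Step c π m)
        (dead : ∀ p → ¬ S.Enabled (c m) p) where

      final : Fin b → T.Config
      final q = extend q σ (c m)

      NewcomerEnabled : Fin b → Set
      NewcomerEnabled q = T.Enabled (final q) newcomer

      move : Fin b → Fin b
      move q with enabled? (final q) newcomer
      ... | yes (t , _) = tgt t
      ... | no _        = q

      move-step : ∀ q → NewcomerEnabled q → T.Step (final q) newcomer (final (move q))
      move-step q enabled with enabled? (final q) newcomer
      ... | yes (t , enabledT) = newcomer-step t enabledT
      ... | no disabled        = ⊥-elim (disabled enabled)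

      solo : ℕ → Fin b
      solo = orbit move (init B)

      solo-path : ∀ k → (∀ j → j < k → NewcomerEnabled (solo j)) →
        PathUpTo T.Step (final ∘ solo) (const newcomer) k
      solo-path k enabled j j<k = move-step (solo j) (enabled j j<k)

      run : ℕ → T.Config
      run = splice m (lift ∘ c) (final ∘ solo)

      schedule : ℕ → Proc (suc n)
      schedule = splice m (old ∘ π) (const newcomer)

      run-initial : T.Initial (run 0)
      run-initial = subst T.Initial (sym (splice-head m refl)) (initial-lift σ (c 0) initial)

      old-disabled : ∀ q p → ¬ T.Enabled (final q) (old p)
      old-disabled q p = dead p ∘ enabled-restrict p

      all-disabled : ∀ q → ¬ NewcomerEnabled q → ∀ p → ¬ T.Enabled (final q) p
      all-disabled q _        pA               = old-disabled q pA
      all-disabled q disabled (pB Fin.zero)    = disabled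
      all-disabled q _        (pB (Fin.suc i)) = old-disabled q (pB i)

      deadlock : T.HasDeadlock
      deadlock with orbit-dichotomy (λ q → enabled? (final q) newcomer) move (init B)
      ... | inj₂ (k , enabled , disabled) =
        inj₁ (m + k , run , schedule , run-initial ,
              splice-path T.Step m k refl (path-lift path) (solo-path k enabled) ,
              λ p → subst (λ x → ¬ T.Enabled x p) (sym (splice-+ m k))
                          (all-disabled (solo k) disabled p))
      ... | inj₁ enabled =
        inj₂ (run , schedule , run-initial ,
              splice-path-∞ T.Step m refl (path-lift path)
                (λ j → solo-path (suc j) (λ i _ → enabled i) j ℕₚ.≤-refl) ,
              pA , m , A-disabled)
        where
        A-disabled : ∀ j → m ≤ j → ¬ T.Enabled (run j) pA
        A-disabled j m≤j with d , refl ← ℕₚ.m≤n⇒∃[o]m+o≡n m≤j =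
          subst (λ x → ¬ T.Enabled x pA) (sym (splice-+ m d)) (old-disabled (solo d) pA)

    deadlock-lifts : S.HasDeadlock → T.HasDeadlock
    deadlock-lifts (inj₁ (m , c , π , initial , path , dead)) =
      AfterGlobalDeadlock.deadlock m c π initial path dead
    deadlock-lifts (inj₂ local) = inj₂ (local-deadlock-lifts local)

init-admitted : ∀ {a b} {A : TemplateA a b} {B : TemplateB a b} n →
  Conjunctive A B → Extension.Admitted A B n (init B)
init-admitted n (conjA , conjB) = (λ t t∈ → proj₂ (conjA t t∈)) , (λ t t∈ → proj₂ (conjB t t∈))

-- With at least one copy of B present, a deadlocked run supplies an input letter of B.
input-of-B : ∀ {a b} {A : TemplateA a b} {B : TemplateB a b} n →
  HasDeadlock A B (suc n) → Fin (alph B)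
input-of-B {A = A} {B} n (inj₁ (_ , c , _)) = System.eB {A = A} {B} {suc n} (proj₂ (c 0)) Fin.zero
input-of-B {A = A} {B} n (inj₂ (c , _))     = System.eB {A = A} {B} {suc n} (proj₂ (c 0)) Fin.zero

-- Theorem 15.  The case n = 0 is excluded by 1 ≤ n; otherwise lift the deadlock,
-- with the newcomer reading the input of B₁ in the initial configuration.
mainTheorem15 : ∀ {a b : ℕ} (A : TemplateA a b) (B : TemplateB a b) →
    Conjunctive A B →
    ∀ (n : ℕ) → 1 ≤ n → HasDeadlock A B n → HasDeadlock A B (suc n)
mainTheorem15 A B conj (suc n) _ deadlock =
  Extension.Lift.deadlock-lifts A B (suc n)
    (init-admitted (suc n) conj) (input-of-B n deadlock) deadlock
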